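{- Let $n\ge1$. The number of partitions of $n$ that contain a part equal to $1$ is $p(n-1)$. Moreover, \[ \sum_{\lambda\vdash n}\sum_{\lambda_i\in\lambda}\mu(\lambda_i)=p(n-1), \] i.e. summed over every partition of $n$, the number of squarefree parts with an even number of prime factors minus the number of squarefree parts with an odd number of prime factors (parts counted with multiplicity) equals $p(n-1)$.
   Context: $\mu$ is the Möbius function. $\lambda\vdash n$ means $\lambda$ is a partition of $n$, and $\sum_{\lambda_i\in\lambda}$ runs over all parts of $\lambda$ counted with multiplicity. $p(m)$ is the number of partitions of $m$, with $p(0)=1$. -}

module Defs where

open import Data.Nat using (ℕ; zero; suc; _+_; _*_; _≤_; _≥_; _∸_)
open import Data.Nat.Divisibility using (_∣_; _∣?_)
open import Data.Nat.Primality using (Prime; prime?)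
open import Data.Integer using (ℤ; +_; -_)
import Data.Integer as ℤ
open import Data.Nat.ListAction using (sum)
open import Data.List using (List; []; _∷_; length; filter; upTo; map; foldr)
open import Data.List.Relation.Unary.All using (All)
open import Data.List.Relation.Unary.Any using (Any)
open import Data.List.Relation.Binary.Pointwise using (Pointwise)
open import Data.List.Relation.Unary.Sorted.TotalOrder as Sorted using ()
open import Data.List.Membership.Propositional using (_∈_)
open import Data.List.Relation.Unary.Unique.Propositional using (Unique)
open import Data.Product using (_×_; ∃)
open import Relation.Nullary using (¬_)
open import Relation.Nullary.Decidable using (_×-dec_; ¬?)
open import Relation.Binary.PropositionalEquality using (_≡_)

data Decreasing : List ℕ → Set where
  []  : Decreasing []
  [_] : ∀ x → Decreasing (x ∷ [])
  _∷_ : ∀ {x y ys} → y ≤ x → Decreasing (y ∷ ys) → Decreasing (x ∷ y ∷ ys)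

IsPartition : ℕ → List ℕ → Set
IsPartition n λs = All (λ x → 1 ≤ x) λs × Decreasing λs × sum λs ≡ n

EnumeratesPartitions : ℕ → List (List ℕ) → Set
EnumeratesPartitions n L =
  Unique L × All (IsPartition n) L × (∀ λs → IsPartition n λs → λs ∈ L)

ω : ℕ → ℕ
ω m = length (filter (λ p → prime? p ×-dec (p ∣? m)) (upTo (suc m)))

primeSquareDivisors : ℕ → List ℕ
primeSquareDivisors m = filter (λ p → prime? p ×-dec ((p * p) ∣? m)) (upTo (suc m))

-- Möbius function (for m ≥ 1): 0 if some prime square divides m,
-- otherwise (-1)^ω(m).
μ : ℕ → ℤ
μ m with primeSquareDivisors m
... | []    = sign (ω m)
  where
  sign : ℕ → ℤ
  sign zero    = + 1
  sign (suc k) = - sign k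
... | _ ∷ _ = + 0

sumμ : List ℕ → ℤ
sumμ λs = foldr (λ x acc → μ x ℤ.+ acc) (+ 0) λs

countWithOne : List (List ℕ) → ℕ
countWithOne L = length (filter (λ λs → Data.List.Membership.DecPropositional._∈?_ Data.Nat._≟_ 1 λs) L)
  where import Data.List.Membership.DecPropositional
        import Data.Nat

module Submission where

-- (i) Removing one part k from the partitions of n that have one is a
-- bijection onto the partitions of n − k, inverse to inserting k; this rests
-- on a sorted list being determined by its multiset of entries.  k = 1 is (i).
-- (ii) Grouping parts by size, Σ_λ Σ_i μ(λᵢ) = Σ_{k ≤ n} M_k(n) μ(k), where
-- M_k(n), the total number of parts equal to k, satisfies
-- M_k(n) = p(n − k) + M_k(n − k) by the same bijection, hence
-- M_k(n) = Σ_{m ≤ n, k ∣ m} p(n − m).  Exchanging sums and using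
-- Σ_{k ∣ m} μ(k) = [m = 1] leaves p(n − 1).
--
-- The partition numbers p(i),
-- i ≤ n, are read off the given enumeration for n.

open import Defs
open import Data.Nat using (ℕ; zero; suc; _+_; _*_; _∸_; _≤_; _<_; _≥_; z≤n; s≤s; _≟_; _≤?_; NonZero; >-nonZero⁻¹)
open import Data.Nat.Properties
  using ( ≤-refl; ≤-trans; ≤-antisym; ≤-decTotalOrder; <⇒≢; <⇒≱; ≰⇒>; suc-injective
        ; +-identityʳ; +-suc; *-comm; *-mono-≤; *-cancelˡ-≡; m≤m+n; m≤m*n
        ; m+n∸m≡n; m+[n∸m]≡n; [m+n]∸[m+o]≡n∸o; m∸n≤m; m∸n≡0⇒m≤n; m∸[m∸n]≡n; ∸-monoʳ-< )
open import Data.Nat.Divisibility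
  using (_∣_; _∣?_; divides; ∣⇒≤; ∣-refl; ∣-trans; 0∣⇒≡0; m∣m*n; n∣m*n; *-monoʳ-∣; *-cancelˡ-∣; ∣m+n∣m⇒∣n; ∣m∣n⇒∣m+n)
open import Data.Nat.Primality using (Prime; prime?; prime⇒nonZero; prime⇒nonTrivial; prime⇒irreducible; euclidsLemma)
open import Data.Nat.Primality.Factorisation using (factorise)
open import Data.Nat.Coprimality using (Coprime; coprime-divisor)
open import Data.Nat.Induction using (<-rec)
open import Data.Nat.ListAction using (sum)
open import Data.Nat.ListAction.Properties using (sum-↭)
open import Data.Integer using (ℤ; +_; -_)
import Data.Integer as ℤ
import Data.Integer.Properties as ℤP
open import Data.Integer.Tactic.RingSolver using (solve-∀)
open import Data.List using (List; []; _∷_; length; foldr; map; filter; upTo; applyDownFrom)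
open import Data.List.Properties using (length-map; map-∘; map-id-local)
open import Data.List.Membership.Propositional using (_∈_; _∉_)
open import Data.List.Membership.DecPropositional _≟_ using (_∈?_)
open import Data.List.Membership.Propositional.Properties
  using (∈-filter⁻; ∈-filter⁺; ∈-map⁻; ∈-map⁺; ∈-upTo⁺; ∈-applyDownFrom⁺; ∈-applyDownFrom⁻)
open import Data.List.Membership.Propositional.Properties.WithK using (unique∧set⇒bag)
open import Data.List.Relation.Binary.BagAndSetEquality using (∼bag⇒↭)
open import Data.List.Relation.Binary.Permutation.Propositional as ↭
  using (_↭_; ↭-refl; ↭-sym; ↭-prep; ↭-swap; ↭-trans; ↭⇒↭ₛ)
open import Data.List.Relation.Binary.Permutation.Propositional.Properties
  using (↭-length; All-resp-↭; ∈-resp-↭; drop-∷)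
open import Data.List.Relation.Binary.Pointwise using (Pointwise-≡⇒≡)
open import Data.List.Relation.Unary.All as All using (All; []; _∷_)
open import Data.List.Relation.Unary.AllPairs using (AllPairs; []; _∷_)
open import Data.List.Relation.Unary.Any using (here; there)
open import Data.List.Relation.Unary.Linked using ([]; [-]; _∷_)
open import Data.List.Relation.Unary.Unique.Propositional using (Unique)
import Data.List.Relation.Unary.Unique.Propositional.Properties as Unique
open import Relation.Binary.Bundles using (DecTotalOrder)
open import Relation.Binary.Definitions using (DecidableEquality)
open import Relation.Binary.Properties.DecTotalOrder ≤-decTotalOrder using (≥-decTotalOrder)
open DecTotalOrder ≥-decTotalOrder using (totalOrder)
open import Data.List.Relation.Unary.Sorted.TotalOrder totalOrder using (Sorted)
open import Data.List.Relation.Unary.Sorted.TotalOrder.Properties using (↗↭↗⇒≋; Sorted⇒AllPairs; AllPairs⇒Sorted)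
open import Data.List.Sort.InsertionSort.Base ≥-decTotalOrder using (insert)
open import Data.List.Sort.InsertionSort.Properties ≥-decTotalOrder using (insert-↭; insert-↗)
open import Data.Product using (_×_; _,_; proj₁; proj₂; ∃-syntax)
open import Data.Sum using (inj₁; inj₂)
open import Data.Empty using (⊥-elim)
open import Function using (case_of_)
open import Function.Bundles using (_⇔_; mk⇔; Equivalence)
open import Relation.Binary.PropositionalEquality as ≡ using (_≡_; _≢_; refl; sym; cong; cong₂; subst)
open import Relation.Nullary using (¬_; Dec; yes; no; ¬?)
open import Relation.Nullary.Decidable using (_×-dec_)
open import Relation.Unary using (Decidable)


-- Finite sums over lists

-- Σ g xs = Σ_{x ∈ xs} g(x), with multiplicity.  Both folds in the statement
-- are instances: sumμ = Σ μ, and the outer fold is Σ sumμ.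
Σ : {A : Set} → (A → ℤ) → List A → ℤ
Σ g = foldr (λ x acc → g x ℤ.+ acc) (+ 0)

𝟙 : {P : Set} → Dec P → ℤ
𝟙 (yes _) = + 1
𝟙 (no _)  = + 0

𝟙-yes : {P : Set} (d : Dec P) → P → 𝟙 d ≡ + 1
𝟙-yes (yes _) _ = refl
𝟙-yes (no ¬p) p with () ← ¬p p

𝟙-no : {P : Set} (d : Dec P) → ¬ P → 𝟙 d ≡ + 0
𝟙-no (yes p) ¬p with () ← ¬p p
𝟙-no (no _)  _  = refl

𝟙-cong : {P Q : Set} (d : Dec P) (e : Dec Q) → (P → Q) → (Q → P) → 𝟙 d ≡ 𝟙 e
𝟙-cong (yes p) e p⇒q _   = sym (𝟙-yes e (p⇒q p))
𝟙-cong (no ¬p) e _   q⇒p = sym (𝟙-no e (λ q → ¬p (q⇒p q)))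

module _ {A : Set} where

  Σ-cong : {f g : A → ℤ} (xs : List A) → (∀ {x} → x ∈ xs → f x ≡ g x) → Σ f xs ≡ Σ g xs
  Σ-cong []       eq = refl
  Σ-cong (x ∷ xs) eq = cong₂ ℤ._+_ (eq (here refl)) (Σ-cong xs (λ x∈ → eq (there x∈)))

  Σ-zero : {f : A → ℤ} (xs : List A) → (∀ {x} → x ∈ xs → f x ≡ + 0) → Σ f xs ≡ + 0
  Σ-zero []       eq = refl
  Σ-zero (x ∷ xs) eq = cong₂ ℤ._+_ (eq (here refl)) (Σ-zero xs (λ x∈ → eq (there x∈)))

  Σ-+ : (f g : A → ℤ) (xs : List A) → Σ (λ x → f x ℤ.+ g x) xs ≡ Σ f xs ℤ.+ Σ g xs
  Σ-+ f g []       = refl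
  Σ-+ f g (x ∷ xs) = ≡.trans (cong (λ t → f x ℤ.+ g x ℤ.+ t) (Σ-+ f g xs))
                             (interchange (f x) (g x) (Σ f xs) (Σ g xs))
    where interchange : ∀ a b c d → a ℤ.+ b ℤ.+ (c ℤ.+ d) ≡ a ℤ.+ c ℤ.+ (b ℤ.+ d)
          interchange = solve-∀

  Σ-*ʳ : (f : A → ℤ) (c : ℤ) (xs : List A) → Σ (λ x → f x ℤ.* c) xs ≡ Σ f xs ℤ.* c
  Σ-*ʳ f c []       = sym (ℤP.*-zeroˡ c)
  Σ-*ʳ f c (x ∷ xs) = ≡.trans (cong (λ t → f x ℤ.* c ℤ.+ t) (Σ-*ʳ f c xs))
                              (sym (ℤP.*-distribʳ-+ c (f x) (Σ f xs)))

  Σ-neg : (f : A → ℤ) (xs : List A) → Σ (λ x → - f x) xs ≡ - Σ f xs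
  Σ-neg f []       = refl
  Σ-neg f (x ∷ xs) = ≡.trans (cong (λ t → - f x ℤ.+ t) (Σ-neg f xs))
                             (sym (ℤP.neg-distrib-+ (f x) (Σ f xs)))

  Σ-ones : (xs : List A) → Σ (λ _ → + 1) xs ≡ + length xs
  Σ-ones []       = refl
  Σ-ones (x ∷ xs) = cong (λ t → + 1 ℤ.+ t) (Σ-ones xs)

  Σ-filter : {P : A → Set} (P? : Decidable P) (g : A → ℤ) (xs : List A) →
             Σ g xs ≡ Σ g (filter P? xs) ℤ.+ Σ g (filter (λ x → ¬? (P? x)) xs)
  Σ-filter P? g [] = refl
  Σ-filter P? g (x ∷ xs) with P? x
  ... | yes _ = ≡.trans (cong (λ t → g x ℤ.+ t) (Σ-filter P? g xs)) (sym (ℤP.+-assoc (g x) _ _))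
  ... | no  _ = ≡.trans (cong (λ t → g x ℤ.+ t) (Σ-filter P? g xs)) (exchange (g x) (Σ g (filter P? xs)) _)
    where exchange : ∀ a b c → a ℤ.+ (b ℤ.+ c) ≡ b ℤ.+ (a ℤ.+ c)
          exchange = solve-∀

  Σ-𝟙 : {P : A → Set} (P? : Decidable P) (g : A → ℤ) (xs : List A) →
        Σ (λ x → 𝟙 (P? x) ℤ.* g x) xs ≡ Σ g (filter P? xs)
  Σ-𝟙 P? g [] = refl
  Σ-𝟙 P? g (x ∷ xs) with P? x
  ... | yes _ = cong₂ ℤ._+_ (ℤP.*-identityˡ (g x)) (Σ-𝟙 P? g xs)
  ... | no  _ = ≡.trans (ℤP.+-identityˡ _) (Σ-𝟙 P? g xs)

  Σ-↭ : (g : A → ℤ) {xs ys : List A} → xs ↭ ys → Σ g xs ≡ Σ g ys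
  Σ-↭ g ↭.refl         = refl
  Σ-↭ g (↭.prep x p)   = cong (λ t → g x ℤ.+ t) (Σ-↭ g p)
  Σ-↭ g (↭.swap x y p) = ≡.trans (exchange (g x) (g y) _) (cong (λ t → g y ℤ.+ (g x ℤ.+ t)) (Σ-↭ g p))
    where exchange : ∀ a b c → a ℤ.+ (b ℤ.+ c) ≡ b ℤ.+ (a ℤ.+ c)
          exchange = solve-∀
  Σ-↭ g (↭.trans p q)  = ≡.trans (Σ-↭ g p) (Σ-↭ g q)

  sameMembers⇒↭ : {xs ys : List A} → Unique xs → Unique ys → (∀ {z} → z ∈ xs ⇔ z ∈ ys) → xs ↭ ys
  sameMembers⇒↭ uxs uys same = ∼bag⇒↭ (unique∧set⇒bag uxs uys same)

  Σ-point : (_≟ᴬ_ : DecidableEquality A) (f : A → ℤ) {ks : List A} {x : A} →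
            Unique ks → x ∈ ks → Σ (λ k → 𝟙 (k ≟ᴬ x) ℤ.* f k) ks ≡ f x
  Σ-point _≟ᴬ_ f {ks} {x} uks x∈ks = begin
    Σ (λ k → 𝟙 (k ≟ᴬ x) ℤ.* f k) ks  ≡⟨ Σ-𝟙 (_≟ᴬ x) f ks ⟩
    Σ f (filter (_≟ᴬ x) ks)          ≡⟨ Σ-↭ f (sameMembers⇒↭ (Unique.filter⁺ (_≟ᴬ x) uks) ([] ∷ []) only-x) ⟩
    f x ℤ.+ + 0                      ≡⟨ ℤP.+-identityʳ (f x) ⟩
    f x                              ∎
    where
    open ≡.≡-Reasoning
    only-x : ∀ {z} → z ∈ filter (_≟ᴬ x) ks ⇔ z ∈ x ∷ []
    only-x = mk⇔ (λ z∈ → here (proj₂ (∈-filter⁻ (_≟ᴬ x) {xs = ks} z∈)))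
                 (λ { (here refl) → ∈-filter⁺ (_≟ᴬ x) x∈ks refl })

module _ {A B : Set} where

  Σ-map : (g : B → ℤ) (f : A → B) (xs : List A) → Σ g (map f xs) ≡ Σ (λ x → g (f x)) xs
  Σ-map g f []       = refl
  Σ-map g f (x ∷ xs) = cong (λ t → g (f x) ℤ.+ t) (Σ-map g f xs)

  Σ-swap : (a : A → B → ℤ) (xs : List A) (ys : List B) →
           Σ (λ x → Σ (a x) ys) xs ≡ Σ (λ y → Σ (λ x → a x y) xs) ys
  Σ-swap a []       ys = sym (Σ-zero ys (λ _ → refl))
  Σ-swap a (x ∷ xs) ys = ≡.trans (cong (λ t → Σ (a x) ys ℤ.+ t) (Σ-swap a xs ys))
                                 (sym (Σ-+ (a x) _ ys))

-- Ranges and divisors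

∣-positive : ∀ {d m} → 1 ≤ m → d ∣ m → 1 ≤ d
∣-positive {zero}  {suc _} _ 0∣m with () ← 0∣⇒≡0 0∣m
∣-positive {suc _}         _ _   = s≤s z≤n

∣-bound : ∀ {d m} → 1 ≤ m → d ∣ m → d ≤ m
∣-bound {m = suc _} _ = ∣⇒≤

-- range n = [n, n − 1, …, 1].
range : ℕ → List ℕ
range = applyDownFrom suc

∈-range⁺ : ∀ {m n} → 1 ≤ m → m ≤ n → m ∈ range n
∈-range⁺ {suc m} _ m<n = ∈-applyDownFrom⁺ suc m<n

∈-range⁻ : ∀ {m n} → m ∈ range n → 1 ≤ m × m ≤ n
∈-range⁻ m∈ with i , i<n , refl ← ∈-applyDownFrom⁻ suc m∈ = s≤s z≤n , i<n

range-unique : ∀ n → Unique (range n)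
range-unique n = Unique.applyDownFrom⁺₁ suc n (λ j<i _ eq → <⇒≢ j<i (sym (suc-injective eq)))

Σ-range-+ : (h : ℕ → ℤ) (k j : ℕ) → Σ h (range (k + j)) ≡ Σ (λ m → h (k + m)) (range j) ℤ.+ Σ h (range k)
Σ-range-+ h k zero    rewrite +-identityʳ k = sym (ℤP.+-identityˡ _)
Σ-range-+ h k (suc j) rewrite +-suc k j = ≡.trans (cong (λ t → h (suc (k + j)) ℤ.+ t) (Σ-range-+ h k j))
                                                  (sym (ℤP.+-assoc (h (suc (k + j))) _ _))

divisors : ℕ → List ℕ
divisors m = filter (_∣? m) (range m)

divisors-unique : ∀ m → Unique (divisors m)
divisors-unique m = Unique.filter⁺ (_∣? m) (range-unique m)

∈-divisors : ∀ {d m} → 1 ≤ m → d ∈ divisors m ⇔ d ∣ m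
∈-divisors {m = m} 1≤m =
  mk⇔ (λ d∈ → proj₂ (∈-filter⁻ (_∣? m) {xs = range m} d∈))
      (λ d∣m → ∈-filter⁺ (_∣? m) (∈-range⁺ (∣-positive 1≤m d∣m) (∣-bound 1≤m d∣m)) d∣m)

divisor-positive : ∀ m {d} → d ∈ divisors m → 1 ≤ d
divisor-positive m d∈ = proj₁ (∈-range⁻ (proj₁ (∈-filter⁻ (_∣? m) {xs = range m} d∈)))

divisors-in-range : ∀ {m n} → 1 ≤ m → m ≤ n → filter (_∣? m) (range n) ↭ divisors m
divisors-in-range {m} {n} 1≤m m≤n =
  sameMembers⇒↭ (Unique.filter⁺ (_∣? m) (range-unique n)) (divisors-unique m) (mk⇔ to′ from′)
  where
  open Equivalence
  to′ : ∀ {k} → k ∈ filter (_∣? m) (range n) → k ∈ divisors m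
  to′ k∈ = from (∈-divisors 1≤m) (proj₂ (∈-filter⁻ (_∣? m) {xs = range n} k∈))
  from′ : ∀ {k} → k ∈ divisors m → k ∈ filter (_∣? m) (range n)
  from′ {k} k∈ = ∈-filter⁺ (_∣? m) (∈-range⁺ (∣-positive 1≤m k∣m) (≤-trans (∣-bound 1≤m k∣m) m≤n)) k∣m
    where k∣m : k ∣ m
          k∣m = to (∈-divisors 1≤m) k∈

-- Prime divisors and the Möbius function

-- The primes q ≤ m satisfying P.  Defs builds both ω and primeSquareDivisors
-- in this form, so their members are characterised once, here.
primesWith : {P : ℕ → Set} → Decidable P → ℕ → List ℕ
primesWith P? m = filter (λ q → prime? q ×-dec P? q) (upTo (suc m))

primesWith-unique : ∀ {P : ℕ → Set} (P? : Decidable P) m → Unique (primesWith P? m)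
primesWith-unique P? m = Unique.filter⁺ (λ q → prime? q ×-dec P? q) (Unique.upTo⁺ (suc m))

∈-primesWith : ∀ {P : ℕ → Set} (P? : Decidable P) {m q} → (∀ {q} → Prime q → P q → q ≤ m) →
               q ∈ primesWith P? m ⇔ (Prime q × P q)
∈-primesWith P? {m} bound =
  mk⇔ (λ q∈ → proj₂ (∈-filter⁻ (λ q → prime? q ×-dec P? q) {xs = upTo (suc m)} q∈))
      (λ { (pq , Pq) → ∈-filter⁺ (λ q → prime? q ×-dec P? q) (∈-upTo⁺ (s≤s (bound pq Pq))) (pq , Pq) })

-- ω m is the length of this list.
primeDivisors : ℕ → List ℕ
primeDivisors m = primesWith (_∣? m) m

∈-primeDivisors : ∀ {m q} → 1 ≤ m → q ∈ primeDivisors m ⇔ (Prime q × q ∣ m)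
∈-primeDivisors 1≤m = ∈-primesWith _ (λ _ → ∣-bound 1≤m)

∈-primeSquareDivisors : ∀ {m q} → 1 ≤ m → q ∈ primeSquareDivisors m ⇔ (Prime q × q * q ∣ m)
∈-primeSquareDivisors 1≤m =
  ∈-primesWith _ (λ pq qq∣m → ≤-trans (m≤m*n _ _ {{prime⇒nonZero pq}}) (∣-bound 1≤m qq∣m))

prime≢1 : ∀ {p} → Prime p → p ≢ 1
prime≢1 pp refl with () ← prime⇒nonTrivial pp

prime∣prime : ∀ {p q} → Prime p → Prime q → q ∣ p → q ≡ p
prime∣prime pp pq q∣p with prime⇒irreducible pp q∣p
... | inj₁ q≡1 = ⊥-elim (prime≢1 pq q≡1)
... | inj₂ q≡p = q≡p

coprime-to-prime : ∀ {p d} → Prime p → ¬ p ∣ d → Coprime d p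
coprime-to-prime pp p∤d (i∣d , i∣p) with prime⇒irreducible pp i∣p
... | inj₁ i≡1  = i≡1
... | inj₂ refl = ⊥-elim (p∤d i∣d)

prime*-positive : ∀ {p k} → Prime p → 1 ≤ k → 1 ≤ p * k
prime*-positive {p} pp 1≤k = *-mono-≤ (>-nonZero⁻¹ p {{prime⇒nonZero pp}}) 1≤k

-- ω(p·k) = ω(k) + 1 for a prime p ∤ k: the prime divisors of p·k are p and
-- those of k.
ω-prime-mul : ∀ {p k} → Prime p → ¬ p ∣ k → 1 ≤ k → ω (p * k) ≡ suc (ω k)
ω-prime-mul {p} {k} pp p∤k 1≤k =
  ↭-length (sameMembers⇒↭ (primesWith-unique _ (p * k))
                          (All.tabulate p-new ∷ primesWith-unique _ k) members)
  where
  open Equivalence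
  p-new : ∀ {q} → q ∈ primeDivisors k → p ≢ q
  p-new q∈ refl = p∤k (proj₂ (to (∈-primeDivisors 1≤k) q∈))
  members : ∀ {q} → q ∈ primeDivisors (p * k) ⇔ q ∈ p ∷ primeDivisors k
  members {q} = mk⇔ to′ from′
    where
    to′ : q ∈ primeDivisors (p * k) → q ∈ p ∷ primeDivisors k
    to′ q∈ with pq , q∣pk ← to (∈-primeDivisors (prime*-positive pp 1≤k)) q∈
               | euclidsLemma p k pq q∣pk
    ... | inj₁ q∣p = here (prime∣prime pp pq q∣p)
    ... | inj₂ q∣k = there (from (∈-primeDivisors 1≤k) (pq , q∣k))
    from′ : q ∈ p ∷ primeDivisors k → q ∈ primeDivisors (p * k)
    from′ (here refl) = from (∈-primeDivisors (prime*-positive pp 1≤k)) (pp , m∣m*n k)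
    from′ (there q∈) with pq , q∣k ← to (∈-primeDivisors 1≤k) q∈ =
      from (∈-primeDivisors (prime*-positive pp 1≤k)) (pq , ∣-trans q∣k (n∣m*n p))

square∣prime-mul : ∀ {p k q} → Prime p → ¬ p ∣ k → Prime q → q * q ∣ p * k → q * q ∣ k
square∣prime-mul {p} {k} {q} pp p∤k pq qq∣pk with q ≟ p
... | yes refl = ⊥-elim (p∤k (*-cancelˡ-∣ p {{prime⇒nonZero pp}} qq∣pk))
... | no  q≢p  = coprime-divisor qq⊥p qq∣pk
  where
  p∤q : ¬ p ∣ q
  p∤q p∣q = q≢p (sym (prime∣prime pq pp p∣q))
  qq⊥p : Coprime (q * q) p
  qq⊥p (i∣qq , i∣p) with prime⇒irreducible pp i∣p
  ... | inj₁ i≡1 = i≡1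
  ... | inj₂ refl with euclidsLemma q q pp i∣qq
  ...   | inj₁ p∣q = ⊥-elim (p∤q p∣q)
  ...   | inj₂ p∣q = ⊥-elim (p∤q p∣q)

μ-nonsquarefree : ∀ m {q} → q ∈ primeSquareDivisors m → μ m ≡ + 0
μ-nonsquarefree m with primeSquareDivisors m
... | []    = λ ()
... | _ ∷ _ = λ _ → refl

μ-flip : ∀ a b → ω a ≡ suc (ω b) →
         (∀ {q} → q ∈ primeSquareDivisors a → q ∈ primeSquareDivisors b) →
         (∀ {q} → q ∈ primeSquareDivisors b → q ∈ primeSquareDivisors a) →
         μ a ≡ - μ b
μ-flip a b ωa≡1+ωb with primeSquareDivisors a | primeSquareDivisors b
... | []    | []    rewrite ωa≡1+ωb = λ _ _ → refl
... | []    | _ ∷ _ = λ _ b⊆a → case b⊆a (here refl) of λ ()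
... | _ ∷ _ | []    = λ a⊆b _ → case a⊆b (here refl) of λ ()
... | _ ∷ _ | _ ∷ _ = λ _ _ → refl

μ-prime-mul : ∀ {p k} → Prime p → ¬ p ∣ k → 1 ≤ k → μ (p * k) ≡ - μ k
μ-prime-mul {p} {k} pp p∤k 1≤k = μ-flip (p * k) k (ω-prime-mul pp p∤k 1≤k) pk⊆k k⊆pk
  where
  open Equivalence
  1≤pk : 1 ≤ p * k
  1≤pk = prime*-positive pp 1≤k
  pk⊆k : ∀ {q} → q ∈ primeSquareDivisors (p * k) → q ∈ primeSquareDivisors k
  pk⊆k q∈ with pq , qq∣pk ← to (∈-primeSquareDivisors 1≤pk) q∈ =
    from (∈-primeSquareDivisors 1≤k) (pq , square∣prime-mul pp p∤k pq qq∣pk)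
  k⊆pk : ∀ {q} → q ∈ primeSquareDivisors k → q ∈ primeSquareDivisors (p * k)
  k⊆pk q∈ with pq , qq∣k ← to (∈-primeSquareDivisors 1≤k) q∈ =
    from (∈-primeSquareDivisors 1≤pk) (pq , ∣-trans qq∣k (n∣m*n p))

-- The divisors of p·M (p prime, M ≥ 1) split into those divisible by p, which
-- are p times the divisors of M, and those prime to p, which are the divisors
-- of M prime to p.  Pairing them up gives Σ_{d ∣ pM} μ(d) = 0.
module DivisorsOfPrimeMultiple {p M : ℕ} (pp : Prime p) (1≤M : 1 ≤ M) where

  private
    open Equivalence
    instance
      p≢0 : NonZero p
      p≢0 = prime⇒nonZero pp
    1≤pM : 1 ≤ p * M
    1≤pM = prime*-positive pp 1≤M

  p∣? : Decidable (p ∣_)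
  p∣? d = p ∣? d

  p∤? : Decidable (λ d → ¬ p ∣ d)
  p∤? d = ¬? (p ∣? d)

  multiples : filter p∣? (divisors (p * M)) ↭ map (p *_) (divisors M)
  multiples = sameMembers⇒↭ (Unique.filter⁺ p∣? (divisors-unique (p * M)))
                            (Unique.map⁺ (*-cancelˡ-≡ _ _ p) (divisors-unique M)) (mk⇔ to′ from′)
    where
    to′ : ∀ {d} → d ∈ filter p∣? (divisors (p * M)) → d ∈ map (p *_) (divisors M)
    to′ d∈ with d∈D , divides e refl ← ∈-filter⁻ p∣? {xs = divisors (p * M)} d∈ rewrite *-comm e p =
      ∈-map⁺ (p *_) (from (∈-divisors 1≤M) (*-cancelˡ-∣ p (to (∈-divisors 1≤pM) d∈D)))
    from′ : ∀ {d} → d ∈ map (p *_) (divisors M) → d ∈ filter p∣? (divisors (p * M))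
    from′ d∈ with e , e∈ , refl ← ∈-map⁻ (p *_) d∈ =
      ∈-filter⁺ p∣? (from (∈-divisors 1≤pM) (*-monoʳ-∣ p (to (∈-divisors 1≤M) e∈))) (m∣m*n e)

  coprimes : filter p∤? (divisors (p * M)) ↭ filter p∤? (divisors M)
  coprimes = sameMembers⇒↭ (Unique.filter⁺ p∤? (divisors-unique (p * M)))
                           (Unique.filter⁺ p∤? (divisors-unique M)) (mk⇔ to′ from′)
    where
    to′ : ∀ {d} → d ∈ filter p∤? (divisors (p * M)) → d ∈ filter p∤? (divisors M)
    to′ d∈ with d∈D , p∤d ← ∈-filter⁻ p∤? {xs = divisors (p * M)} d∈ =
      ∈-filter⁺ p∤? (from (∈-divisors 1≤M)
        (coprime-divisor (coprime-to-prime pp p∤d) (to (∈-divisors 1≤pM) d∈D))) p∤d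
    from′ : ∀ {d} → d ∈ filter p∤? (divisors M) → d ∈ filter p∤? (divisors (p * M))
    from′ d∈ with d∈D , p∤d ← ∈-filter⁻ p∤? {xs = divisors M} d∈ =
      ∈-filter⁺ p∤? (from (∈-divisors 1≤pM) (∣-trans (to (∈-divisors 1≤M) d∈D) (n∣m*n p))) p∤d

  -- Σ_{d ∣ M} μ(p·d) = −Σ_{d ∣ M, p ∤ d} μ(d): the terms with p ∣ d vanish
  -- since p² ∣ p·d, the others change sign.
  Σ-μ-multiples : Σ (λ d → μ (p * d)) (divisors M) ≡ - Σ μ (filter p∤? (divisors M))
  Σ-μ-multiples = begin
    Σ (λ d → μ (p * d)) (divisors M)
      ≡⟨ Σ-filter p∣? (λ d → μ (p * d)) (divisors M) ⟩
    Σ (λ d → μ (p * d)) (filter p∣? (divisors M)) ℤ.+ Σ (λ d → μ (p * d)) (filter p∤? (divisors M))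
      ≡⟨ cong₂ ℤ._+_ (Σ-zero (filter p∣? (divisors M)) vanishing) (Σ-cong (filter p∤? (divisors M)) negated) ⟩
    + 0 ℤ.+ Σ (λ d → - μ d) (filter p∤? (divisors M))
      ≡⟨ ℤP.+-identityˡ _ ⟩
    Σ (λ d → - μ d) (filter p∤? (divisors M))
      ≡⟨ Σ-neg μ (filter p∤? (divisors M)) ⟩
    - Σ μ (filter p∤? (divisors M)) ∎
    where
    open ≡.≡-Reasoning
    vanishing : ∀ {d} → d ∈ filter p∣? (divisors M) → μ (p * d) ≡ + 0
    vanishing d∈ with d∈D , p∣d ← ∈-filter⁻ p∣? {xs = divisors M} d∈ =
      μ-nonsquarefree (p * _) (from (∈-primeSquareDivisors (prime*-positive pp (divisor-positive M d∈D)))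
                                    (pp , *-monoʳ-∣ p p∣d))
    negated : ∀ {d} → d ∈ filter p∤? (divisors M) → μ (p * d) ≡ - μ d
    negated d∈ with d∈D , p∤d ← ∈-filter⁻ p∤? {xs = divisors M} d∈ = μ-prime-mul pp p∤d (divisor-positive M d∈D)

  Σ-μ-divisors-prime-multiple : Σ μ (divisors (p * M)) ≡ + 0
  Σ-μ-divisors-prime-multiple = begin
    Σ μ (divisors (p * M))
      ≡⟨ Σ-filter p∣? μ (divisors (p * M)) ⟩
    Σ μ (filter p∣? (divisors (p * M))) ℤ.+ Σ μ (filter p∤? (divisors (p * M)))
      ≡⟨ cong₂ ℤ._+_ (≡.trans (Σ-↭ μ multiples) (Σ-map μ (p *_) (divisors M))) (Σ-↭ μ coprimes) ⟩
    Σ (λ d → μ (p * d)) (divisors M) ℤ.+ S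
      ≡⟨ cong (ℤ._+ S) Σ-μ-multiples ⟩
    - S ℤ.+ S
      ≡⟨ ℤP.+-inverseˡ S ⟩
    + 0 ∎
    where
    open ≡.≡-Reasoning
    S : ℤ
    S = Σ μ (filter p∤? (divisors M))

primeFactor : ∀ m → 2 ≤ m → ∃[ p ] (Prime p × p ∣ m)
primeFactor 1 (s≤s ())
primeFactor m@(suc (suc _)) _ with factorise m
... | record { factors = [] ; isFactorisation = () }
... | record { factors = p ∷ _ ; isFactorisation = m≡Πps ; factorsPrime = pp ∷ _ } =
  p , pp , subst (p ∣_) (sym m≡Πps) (m∣m*n _)

Σ-μ-divisors : ∀ m → 1 ≤ m → Σ μ (divisors m) ≡ 𝟙 (m ≟ 1)
Σ-μ-divisors 1 _ = refl
Σ-μ-divisors m@(suc (suc _)) 1≤m with p , pp , divides M m≡M*p ← primeFactor m (s≤s (s≤s z≤n)) =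
  let m≡p*M = ≡.trans m≡M*p (*-comm M p) in
  ≡.trans (cong (λ t → Σ μ (divisors t)) m≡p*M)
          (DivisorsOfPrimeMultiple.Σ-μ-divisors-prime-multiple pp (∣-positive 1≤m (divides p m≡p*M)))

möbius-sieve : (c : ℕ → ℤ) (n : ℕ) → 1 ≤ n →
  Σ (λ k → Σ (λ m → 𝟙 (k ∣? m) ℤ.* c m) (range n) ℤ.* μ k) (range n) ≡ c 1
möbius-sieve c n 1≤n = begin
  Σ (λ k → Σ (λ m → 𝟙 (k ∣? m) ℤ.* c m) (range n) ℤ.* μ k) (range n)
    ≡⟨ Σ-cong (range n) (λ {k} _ → sym (Σ-*ʳ (λ m → 𝟙 (k ∣? m) ℤ.* c m) (μ k) (range n))) ⟩
  Σ (λ k → Σ (λ m → 𝟙 (k ∣? m) ℤ.* c m ℤ.* μ k) (range n)) (range n)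
    ≡⟨ Σ-swap (λ k m → 𝟙 (k ∣? m) ℤ.* c m ℤ.* μ k) (range n) (range n) ⟩
  Σ (λ m → Σ (λ k → 𝟙 (k ∣? m) ℤ.* c m ℤ.* μ k) (range n)) (range n)
    ≡⟨ Σ-cong (range n) (λ {m} m∈ → ≡.trans (Σ-cong (range n) (λ {k} _ → rearrange (𝟙 (k ∣? m)) (c m) (μ k)))
                                             (≡.trans (Σ-*ʳ (λ k → 𝟙 (k ∣? m) ℤ.* μ k) (c m) (range n))
                                                      (cong (ℤ._* c m) (Σ-μ-range m∈)))) ⟩
  Σ (λ m → 𝟙 (m ≟ 1) ℤ.* c m) (range n)
    ≡⟨ Σ-point _≟_ c (range-unique n) (∈-range⁺ ≤-refl 1≤n) ⟩
  c 1 ∎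
  where
  open ≡.≡-Reasoning
  rearrange : ∀ a b c → a ℤ.* b ℤ.* c ≡ a ℤ.* c ℤ.* b
  rearrange = solve-∀
  Σ-μ-range : ∀ {m} → m ∈ range n → Σ (λ k → 𝟙 (k ∣? m) ℤ.* μ k) (range n) ≡ 𝟙 (m ≟ 1)
  Σ-μ-range {m} m∈ = let 1≤m , m≤n = ∈-range⁻ m∈ in begin
    Σ (λ k → 𝟙 (k ∣? m) ℤ.* μ k) (range n) ≡⟨ Σ-𝟙 (_∣? m) μ (range n) ⟩
    Σ μ (filter (_∣? m) (range n))         ≡⟨ Σ-↭ μ (divisors-in-range 1≤m m≤n) ⟩
    Σ μ (divisors m)                       ≡⟨ Σ-μ-divisors m 1≤m ⟩
    𝟙 (m ≟ 1)                              ∎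

-- Partitions as sorted lists

decreasing⇒sorted : ∀ {xs} → Decreasing xs → Sorted xs
decreasing⇒sorted []         = []
decreasing⇒sorted [ x ]      = [-]
decreasing⇒sorted (y≤x ∷ ds) = y≤x ∷ decreasing⇒sorted ds

sorted⇒decreasing : ∀ {xs} → Sorted xs → Decreasing xs
sorted⇒decreasing []         = []
sorted⇒decreasing [-]        = [ _ ]
sorted⇒decreasing (y≤x ∷ ss) = y≤x ∷ sorted⇒decreasing ss

sorted-↭⇒≡ : ∀ {xs ys} → Sorted xs → Sorted ys → xs ↭ ys → xs ≡ ys
sorted-↭⇒≡ sxs sys xs↭ys = Pointwise-≡⇒≡ (↗↭↗⇒≋ totalOrder sxs sys (↭⇒↭ₛ xs↭ys))

remove : ℕ → List ℕ → List ℕ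
remove k [] = []
remove k (x ∷ xs) with x ≟ k
... | yes _ = xs
... | no  _ = x ∷ remove k xs

remove-↭ : ∀ {k xs} → k ∈ xs → xs ↭ k ∷ remove k xs
remove-↭ {k} {x ∷ xs} k∈ with x ≟ k | k∈
... | yes refl | _          = ↭-refl
... | no  x≢k  | here refl  = ⊥-elim (x≢k refl)
... | no  x≢k  | there k∈xs = ↭-trans (↭-prep x (remove-↭ k∈xs)) (↭-swap x k ↭-refl)

remove-all : ∀ {P : ℕ → Set} k {xs} → All P xs → All P (remove k xs)
remove-all k []                   = []
remove-all k {x ∷ xs} (px ∷ pxs) with x ≟ k
... | yes _ = pxs
... | no  _ = px ∷ remove-all k pxs

remove-sorted : ∀ k {xs} → Sorted xs → Sorted (remove k xs)
remove-sorted k sxs = AllPairs⇒Sorted totalOrder (remove-pairs (Sorted⇒AllPairs totalOrder sxs))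
  where
  remove-pairs : ∀ {xs} → AllPairs _≥_ xs → AllPairs _≥_ (remove k xs)
  remove-pairs []                   = []
  remove-pairs {x ∷ xs} (x≥ ∷ pairs) with x ≟ k
  ... | yes _ = pairs
  ... | no  _ = remove-all k x≥ ∷ remove-pairs pairs

insert-remove : ∀ {k xs} → Sorted xs → k ∈ xs → insert k (remove k xs) ≡ xs
insert-remove {k} {xs} sxs k∈ =
  sorted-↭⇒≡ (insert-↗ k (remove-sorted k sxs)) sxs (↭-trans (insert-↭ k _) (↭-sym (remove-↭ k∈)))

∈-insert : ∀ k xs → k ∈ insert k xs
∈-insert k xs = ∈-resp-↭ (↭-sym (insert-↭ k xs)) (here refl)

remove-insert : ∀ {k xs} → Sorted xs → remove k (insert k xs) ≡ xs
remove-insert {k} {xs} sxs =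
  sorted-↭⇒≡ (remove-sorted k (insert-↗ k sxs)) sxs
             (drop-∷ (↭-trans (↭-sym (remove-↭ (∈-insert k xs))) (insert-↭ k xs)))

remove-partition : ∀ {n k λs} → IsPartition n λs → k ∈ λs → IsPartition (n ∸ k) (remove k λs)
remove-partition {n} {k} {λs} (positive , decreasing , sum≡n) k∈ =
  All.tail (All-resp-↭ (remove-↭ k∈) positive) ,
  sorted⇒decreasing (remove-sorted k (decreasing⇒sorted decreasing)) ,
  (begin
    sum (remove k λs)          ≡⟨ sym (m+n∸m≡n k _) ⟩
    k + sum (remove k λs) ∸ k  ≡⟨ cong (_∸ k) (sym (sum-↭ (remove-↭ k∈))) ⟩
    sum λs ∸ k                 ≡⟨ cong (_∸ k) sum≡n ⟩
    n ∸ k                      ∎)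
  where open ≡.≡-Reasoning

insert-partition : ∀ {n k μs} → 1 ≤ k → k ≤ n → IsPartition (n ∸ k) μs → IsPartition n (insert k μs)
insert-partition {n} {k} {μs} 1≤k k≤n (positive , decreasing , sum≡n∸k) =
  All-resp-↭ (↭-sym (insert-↭ k μs)) (1≤k ∷ positive) ,
  sorted⇒decreasing (insert-↗ k (decreasing⇒sorted decreasing)) ,
  (begin
    sum (insert k μs)  ≡⟨ sum-↭ (insert-↭ k μs) ⟩
    k + sum μs         ≡⟨ cong (λ t → k + t) sum≡n∸k ⟩
    k + (n ∸ k)        ≡⟨ m+[n∸m]≡n k≤n ⟩
    n                  ∎)
  where open ≡.≡-Reasoning

enumerations-↭ : ∀ {n A B} → EnumeratesPartitions n A → EnumeratesPartitions n B → A ↭ B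
enumerations-↭ (uA , partsA , completeA) (uB , partsB , completeB) =
  sameMembers⇒↭ uA uB (mk⇔ (λ λs∈ → completeB _ (All.lookup partsA λs∈))
                           (λ λs∈ → completeA _ (All.lookup partsB λs∈)))

withoutPart : ℕ → List (List ℕ) → List (List ℕ)
withoutPart k L = map (remove k) (filter (k ∈?_) L)

-- If L enumerates the partitions of n, then withoutPart k L enumerates
-- those of n ∸ k: removing a part k is a bijection, inverse to inserting k.
enumerate-withoutPart : ∀ {n k L} → 1 ≤ k → k ≤ n → EnumeratesPartitions n L →
                        EnumeratesPartitions (n ∸ k) (withoutPart k L)
enumerate-withoutPart {n} {k} {L} 1≤k k≤n (unique , partitions , complete) =
  removed-unique , All.tabulate removed-partition , removed-complete
  where
  F : List (List ℕ)
  F = filter (k ∈?_) L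
  ∈F⁻ : ∀ {λs} → λs ∈ F → IsPartition n λs × k ∈ λs
  ∈F⁻ λs∈ = let λs∈L , k∈λs = ∈-filter⁻ (k ∈?_) {xs = L} λs∈ in All.lookup partitions λs∈L , k∈λs
  reinsert : map (insert k) (withoutPart k L) ≡ F
  reinsert = ≡.trans (sym (map-∘ F)) (map-id-local (All.tabulate λ λs∈ →
               let (_ , decreasing , _) , k∈λs = ∈F⁻ λs∈ in insert-remove (decreasing⇒sorted decreasing) k∈λs))
  removed-unique : Unique (withoutPart k L)
  removed-unique = Unique.map⁻ (subst Unique (sym reinsert) (Unique.filter⁺ (k ∈?_) unique))
  removed-partition : ∀ {μs} → μs ∈ withoutPart k L → IsPartition (n ∸ k) μs
  removed-partition μs∈ with λs , λs∈ , refl ← ∈-map⁻ (remove k) μs∈ =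
    let partition , k∈λs = ∈F⁻ λs∈ in remove-partition partition k∈λs
  removed-complete : ∀ μs → IsPartition (n ∸ k) μs → μs ∈ withoutPart k L
  removed-complete μs partition@(_ , decreasing , _) =
    subst (_∈ withoutPart k L) (remove-insert (decreasing⇒sorted decreasing))
      (∈-map⁺ (remove k) (∈-filter⁺ (k ∈?_) (complete _ (insert-partition 1≤k k≤n partition)) (∈-insert k μs)))

-- Multiplicities of parts

mult : ℕ → List ℕ → ℤ
mult k = Σ (λ x → 𝟙 (k ≟ x))

mult-remove : ∀ {k λs} → k ∈ λs → mult k λs ≡ + 1 ℤ.+ mult k (remove k λs)
mult-remove {k} {λs} k∈ = ≡.trans (Σ-↭ (λ x → 𝟙 (k ≟ x)) (remove-↭ k∈))
                                  (cong (ℤ._+ mult k (remove k λs)) (𝟙-yes (k ≟ k) refl))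

mult-absent : ∀ {k λs} → k ∉ λs → mult k λs ≡ + 0
mult-absent {k} {λs} k∉ = Σ-zero λs (λ x∈ → 𝟙-no (k ≟ _) (λ { refl → k∉ x∈ }))

Σ-by-multiplicity : ∀ (f : ℕ → ℤ) n {λs} → All (λ x → 1 ≤ x × x ≤ n) λs →
                    Σ f λs ≡ Σ (λ k → mult k λs ℤ.* f k) (range n)
Σ-by-multiplicity f n {λs} bounded = begin
  Σ f λs
    ≡⟨ Σ-cong λs (λ x∈ → let 1≤x , x≤n = All.lookup bounded x∈ in
                   sym (Σ-point _≟_ f (range-unique n) (∈-range⁺ 1≤x x≤n))) ⟩
  Σ (λ x → Σ (λ k → 𝟙 (k ≟ x) ℤ.* f k) (range n)) λs
    ≡⟨ Σ-swap (λ x k → 𝟙 (k ≟ x) ℤ.* f k) λs (range n) ⟩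
  Σ (λ k → Σ (λ x → 𝟙 (k ≟ x) ℤ.* f k) λs) (range n)
    ≡⟨ Σ-cong (range n) (λ {k} _ → Σ-*ʳ (λ x → 𝟙 (k ≟ x)) (f k) λs) ⟩
  Σ (λ k → mult k λs ℤ.* f k) (range n) ∎
  where open ≡.≡-Reasoning

parts-bounded : ∀ {n λs} → IsPartition n λs → All (λ x → 1 ≤ x × x ≤ n) λs
parts-bounded {λs = λs} (positive , _ , sum≡n) =
  All.tabulate (λ x∈ → All.lookup positive x∈ , subst (_ ≤_) sum≡n (part≤sum x∈))
  where part≤sum : ∀ {x} → x ∈ λs → x ≤ sum λs
        part≤sum {x} x∈ = subst (x ≤_) (sym (sum-↭ (remove-↭ x∈))) (m≤m+n x _)

Σ-over-partitions : ∀ (f : ℕ → ℤ) {n L} → EnumeratesPartitions n L →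
  Σ (Σ f) L ≡ Σ (λ k → Σ (mult k) L ℤ.* f k) (range n)
Σ-over-partitions f {n} {L} (_ , partitions , _) = begin
  Σ (Σ f) L
    ≡⟨ Σ-cong L (λ λs∈ → Σ-by-multiplicity f n (parts-bounded (All.lookup partitions λs∈))) ⟩
  Σ (λ λs → Σ (λ k → mult k λs ℤ.* f k) (range n)) L
    ≡⟨ Σ-swap (λ λs k → mult k λs ℤ.* f k) L (range n) ⟩
  Σ (λ k → Σ (λ λs → mult k λs ℤ.* f k) L) (range n)
    ≡⟨ Σ-cong (range n) (λ {k} _ → Σ-*ʳ (mult k) (f k) L) ⟩
  Σ (λ k → Σ (mult k) L ℤ.* f k) (range n) ∎
  where open ≡.≡-Reasoning

-- Counting parts equal to k: every partition in L containing k contributes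
-- one such part plus those of the partition left after removing it.
Σ-mult-step : ∀ k L → Σ (mult k) L ≡ + length (withoutPart k L) ℤ.+ Σ (mult k) (withoutPart k L)
Σ-mult-step k L = begin
  Σ (mult k) L
    ≡⟨ Σ-filter (k ∈?_) (mult k) L ⟩
  Σ (mult k) F ℤ.+ Σ (mult k) F̄
    ≡⟨ cong (λ t → Σ (mult k) F ℤ.+ t) (Σ-zero F̄ absent) ⟩
  Σ (mult k) F ℤ.+ + 0
    ≡⟨ ℤP.+-identityʳ _ ⟩
  Σ (mult k) F
    ≡⟨ Σ-cong F (λ λs∈ → mult-remove (proj₂ (∈-filter⁻ (k ∈?_) {xs = L} λs∈))) ⟩
  Σ (λ λs → + 1 ℤ.+ mult k (remove k λs)) F
    ≡⟨ Σ-+ (λ _ → + 1) (λ λs → mult k (remove k λs)) F ⟩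
  Σ (λ _ → + 1) F ℤ.+ Σ (λ λs → mult k (remove k λs)) F
    ≡⟨ cong₂ ℤ._+_ (≡.trans (Σ-ones F) (cong +_ (sym (length-map (remove k) F))))
                   (sym (Σ-map (mult k) (remove k) F)) ⟩
  + length (withoutPart k L) ℤ.+ Σ (mult k) (withoutPart k L) ∎
  where
  open ≡.≡-Reasoning
  F F̄ : List (List ℕ)
  F = filter (k ∈?_) L
  F̄ = filter (λ λs → ¬? (k ∈? λs)) L
  absent : ∀ {λs} → λs ∈ F̄ → mult k λs ≡ + 0
  absent λs∈ = mult-absent (proj₂ (∈-filter⁻ (λ λs → ¬? (k ∈? λs)) {xs = L} λs∈))

multiplesSum : (ℕ → ℕ) → ℕ → ℕ → ℤ
multiplesSum p k n = Σ (λ m → 𝟙 (k ∣? m) ℤ.* + p (n ∸ m)) (range n)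

multiplesSum-< : ∀ p {k n} → n < k → multiplesSum p k n ≡ + 0
multiplesSum-< p {k} {n} n<k = Σ-zero (range n) no-multiple
  where
  no-multiple : ∀ {m} → m ∈ range n → 𝟙 (k ∣? m) ℤ.* + p (n ∸ m) ≡ + 0
  no-multiple {m} m∈ = let 1≤m , m≤n = ∈-range⁻ m∈ in
    cong (ℤ._* + p (n ∸ m)) (𝟙-no (k ∣? m) (λ k∣m → <⇒≱ n<k (≤-trans (∣-bound 1≤m k∣m) m≤n)))

-- Among 1 … k + j, the multiples of k are k itself and k plus the multiples up to j.
multiplesSum-+ : ∀ p {k} j → 1 ≤ k → multiplesSum p k (k + j) ≡ + p j ℤ.+ multiplesSum p k j
multiplesSum-+ p {k} j 1≤k = begin
  multiplesSum p k (k + j)                               ≡⟨ Σ-range-+ term k j ⟩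
  Σ (λ m → term (k + m)) (range j) ℤ.+ Σ term (range k)  ≡⟨ cong₂ ℤ._+_ shifted-multiples only-k ⟩
  multiplesSum p k j ℤ.+ + p j                           ≡⟨ ℤP.+-comm (multiplesSum p k j) (+ p j) ⟩
  + p j ℤ.+ multiplesSum p k j                           ∎
  where
  open ≡.≡-Reasoning
  term : ℕ → ℤ
  term m = 𝟙 (k ∣? m) ℤ.* + p (k + j ∸ m)
  -- k + m is a multiple of k iff m is.
  shifted-multiples : Σ (λ m → term (k + m)) (range j) ≡ multiplesSum p k j
  shifted-multiples = Σ-cong (range j) (λ {m} _ → cong₂ ℤ._*_
    (𝟙-cong (k ∣? (k + m)) (k ∣? m) (λ k∣k+m → ∣m+n∣m⇒∣n k∣k+m ∣-refl) (∣m∣n⇒∣m+n ∣-refl))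
    (cong (λ t → + p t) ([m+n]∸[m+o]≡n∸o k j m)))
  -- The only multiple of k in 1 … k is k.
  only-k : Σ term (range k) ≡ + p j
  only-k = begin
    Σ term (range k)                                   ≡⟨ Σ-cong (range k) multiple⇔k ⟩
    Σ (λ m → 𝟙 (m ≟ k) ℤ.* + p (k + j ∸ m)) (range k)  ≡⟨ Σ-point _≟_ (λ m → + p (k + j ∸ m)) (range-unique k) (∈-range⁺ 1≤k ≤-refl) ⟩
    + p (k + j ∸ k)                                    ≡⟨ cong (λ t → + p t) (m+n∸m≡n k j) ⟩
    + p j                                              ∎
    where
    multiple⇔k : ∀ {m} → m ∈ range k → term m ≡ 𝟙 (m ≟ k) ℤ.* + p (k + j ∸ m)
    multiple⇔k {m} m∈ = let 1≤m , m≤k = ∈-range⁻ m∈ in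
      cong (ℤ._* + p (k + j ∸ m))
           (𝟙-cong (k ∣? m) (m ≟ k) (λ k∣m → ≤-antisym m≤k (∣-bound 1≤m k∣m)) (λ { refl → ∣-refl }))

CountsPartitionsUpTo : ℕ → (ℕ → ℕ) → Set
CountsPartitionsUpTo N p = ∀ {i L} → i ≤ N → EnumeratesPartitions i L → length L ≡ p i

Σ-mult : ∀ {N p k} → CountsPartitionsUpTo N p → 1 ≤ k →
         ∀ n {L} → n ≤ N → EnumeratesPartitions n L → Σ (mult k) L ≡ multiplesSum p k n
Σ-mult {N} {p} {k} counts 1≤k = <-rec Goal step
  where
  Goal : ℕ → Set
  Goal n = ∀ {L} → n ≤ N → EnumeratesPartitions n L → Σ (mult k) L ≡ multiplesSum p k n
  step : ∀ n → (∀ {j} → j < n → Goal j) → Goal n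
  step n ih {L} n≤N enum@(_ , partitions , _) with k ≤? n
  ... | no k≰n = ≡.trans (Σ-zero L (λ λs∈ → mult-absent (too-big (All.lookup partitions λs∈))))
                         (sym (multiplesSum-< p (≰⇒> k≰n)))
    where too-big : ∀ {λs} → IsPartition n λs → k ∉ λs
          too-big partition k∈ = k≰n (proj₂ (All.lookup (parts-bounded partition) k∈))
  ... | yes k≤n = begin
    Σ (mult k) L                          ≡⟨ Σ-mult-step k L ⟩
    + length L′ ℤ.+ Σ (mult k) L′         ≡⟨ cong₂ ℤ._+_ (cong +_ (counts j≤N enum′)) (ih j<n j≤N enum′) ⟩
    + p j ℤ.+ multiplesSum p k j          ≡⟨ sym (multiplesSum-+ p j 1≤k) ⟩
    multiplesSum p k (k + j)              ≡⟨ cong (multiplesSum p k) (m+[n∸m]≡n k≤n) ⟩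
    multiplesSum p k n                    ∎
    where
    open ≡.≡-Reasoning
    j : ℕ
    j = n ∸ k
    L′ : List (List ℕ)
    L′ = withoutPart k L
    enum′ : EnumeratesPartitions j L′
    enum′ = enumerate-withoutPart 1≤k k≤n enum
    j<n : j < n
    j<n = ∸-monoʳ-< 1≤k k≤n
    j≤N : j ≤ N
    j≤N = ≤-trans (m∸n≤m n k) n≤N

enumerationBelow : ℕ → List (List ℕ) → ℕ → List (List ℕ)
enumerationBelow n L i with n ∸ i
... | zero  = L
... | suc d = withoutPart (suc d) L

enumerationBelow-enumerates : ∀ {n L i} → EnumeratesPartitions n L → i ≤ n →
                              EnumeratesPartitions i (enumerationBelow n L i)
enumerationBelow-enumerates {n} {L} {i} enum i≤n with n ∸ i in n∸i≡
... | zero  = subst (λ t → EnumeratesPartitions t L) (≤-antisym (m∸n≡0⇒m≤n n∸i≡) i≤n) enum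
... | suc d = subst (λ t → EnumeratesPartitions t (withoutPart (suc d) L)) n∸[n∸i]≡i
                      (enumerate-withoutPart (s≤s z≤n) (subst (_≤ n) n∸i≡ (m∸n≤m n i)) enum)
  where n∸[n∸i]≡i : n ∸ suc d ≡ i
        n∸[n∸i]≡i = ≡.trans (cong (n ∸_) (sym n∸i≡)) (m∸[m∸n]≡n i≤n)

partitionCount : ℕ → List (List ℕ) → ℕ → ℕ
partitionCount n L i = length (enumerationBelow n L i)

partitionCount-counts : ∀ {n L} → EnumeratesPartitions n L → CountsPartitionsUpTo n (partitionCount n L)
partitionCount-counts enum i≤n enum′ = ↭-length (enumerations-↭ enum′ (enumerationBelow-enumerates enum i≤n))

corollary6 : (n : ℕ) → n ≥ 1 →
    (L : List (List ℕ)) → EnumeratesPartitions n L →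
    (L′ : List (List ℕ)) → EnumeratesPartitions (n ∸ 1) L′ →
      (countWithOne L ≡ length L′)
      × (foldr (λ λs acc → sumμ λs ℤ.+ acc) (+ 0) L ≡ + (length L′))
corollary6 n 1≤n L enum L′ enum′ = partsOne , möbiusSum
  where
  open ≡.≡-Reasoning
  p : ℕ → ℕ
  p = partitionCount n L
  counts : CountsPartitionsUpTo n p
  counts = partitionCount-counts enum
  -- Removing a part 1 matches the partitions of n containing 1 with those of n ∸ 1.
  partsOne : countWithOne L ≡ length L′
  partsOne = begin
    countWithOne L            ≡⟨ sym (length-map (remove 1) (filter (1 ∈?_) L)) ⟩
    length (withoutPart 1 L)  ≡⟨ ↭-length (enumerations-↭ (enumerate-withoutPart ≤-refl 1≤n enum) enum′) ⟩
    length L′                 ∎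
  -- Group the parts by size, count each size with Σ-mult, then sieve with μ.
  möbiusSum : Σ (Σ μ) L ≡ + length L′
  möbiusSum = begin
    Σ (Σ μ) L                                       ≡⟨ Σ-over-partitions μ enum ⟩
    Σ (λ k → Σ (mult k) L ℤ.* μ k) (range n)        ≡⟨ Σ-cong (range n) (λ {k} k∈ → cong (ℤ._* μ k)
                                                         (Σ-mult counts (proj₁ (∈-range⁻ k∈)) n ≤-refl enum)) ⟩
    Σ (λ k → multiplesSum p k n ℤ.* μ k) (range n)  ≡⟨ möbius-sieve (λ m → + p (n ∸ m)) n 1≤n ⟩
    + p (n ∸ 1)                                     ≡⟨ cong +_ (sym (counts (m∸n≤m n 1) enum′)) ⟩
    + length L′                                     ∎
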